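{- Let $n\ge1$ and let $u,v\in\mathbb{N}^n\setminus\{0\}$. In the two-move vector subtraction game on $\mathbb{N}^n$ defined by the vectors $\{ -u,-v\}$, one has $\mathcal{SG}(x)=\mathcal{SG}(x+u+v)$ for all $x\in\mathbb{N}^n$.
   Context: The vector subtraction game defined by $\{ -u,-v\}$ is the impartial normal-play game on positions $x\in\mathbb{N}^n$ where a move replaces $x$ by $x-u$ or $x-v$, provided the result lies in $\mathbb{N}^n$. $\mathcal{SG}(x)$ is the Sprague–Grundy value of $x$. -}

module Defs where

open import Data.Nat using (ℕ; zero; suc; _+_; _∸_; _≤?_)
open import Data.Nat.Properties using (_≟_)
open import Data.Bool using (Bool; true; false; _∧_; if_then_else_)
open import Data.List using (List; []; _∷_; length; _++_)
open import Data.List.Membership.DecPropositional _≟_ using (_∈?_)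
open import Data.Vec using (Vec; []; _∷_; zipWith; foldr)
open import Relation.Nullary.Decidable using (⌊_⌋)

_+ᵛ_ : ∀ {n} → Vec ℕ n → Vec ℕ n → Vec ℕ n
_+ᵛ_ = zipWith _+_

_∸ᵛ_ : ∀ {n} → Vec ℕ n → Vec ℕ n → Vec ℕ n
_∸ᵛ_ = zipWith _∸_

_≤ᵛ_ : ∀ {n} → Vec ℕ n → Vec ℕ n → Bool
[] ≤ᵛ [] = true
(a ∷ as) ≤ᵛ (b ∷ bs) = ⌊ a ≤? b ⌋ ∧ (as ≤ᵛ bs)

Σᵛ : ∀ {n} → Vec ℕ n → ℕ
Σᵛ = foldr _ _+_ 0

-- minimum excludant: least natural number not in the list
-- (it is always ≤ length l, so the search below suffices)
mex : List ℕ → ℕ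
mex l = search (suc (length l)) 0
  where
  search : ℕ → ℕ → ℕ
  search zero k = k
  search (suc f) k = if ⌊ k ∈? l ⌋ then search f (suc k) else k

module _ {n : ℕ} (u v : Vec ℕ n) where

  sgFuel : ℕ → Vec ℕ n → ℕ
  sgFuel zero x = 0
  sgFuel (suc f) x = mex (optU ++ optV)
    where
    optU : List ℕ
    optU = if u ≤ᵛ x then sgFuel f (x ∸ᵛ u) ∷ [] else []
    optV : List ℕ
    optV = if v ≤ᵛ x then sgFuel f (x ∸ᵛ v) ∷ [] else []

  -- When u, v ≠ 0 every move lowers the coordinate sum by at least 1,
  -- so fuel  Σᵛ x + 1  exceeds the length of any play from x and
  -- sgFuel computes the genuine Sprague–Grundy value mex{SG(x-u), SG(x-v)}.
  SG : Vec ℕ n → ℕ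
  SG x = sgFuel (suc (Σᵛ x)) x

{-# OPTIONS --safe #-}
-- Write y = x + u + v. Its two options are x + v and x + u, so SG y = mex {SG (x + v), SG (x + u)}.
-- By induction on the coordinate sum, the options x - u and x - v of x (when present) have the
-- values SG (x + v) and SG (x + u), so SG x is the mex of a subset of these two values. Neither
-- value equals SG x, because x is itself an option of both x + u and x + v; hence adding the
-- missing values does not change the mex, and SG x = SG y.
module Submission where

open import Defs
open import Data.Nat using (ℕ; _≤_)
open import Data.Vec using (Vec; replicate)
open import Relation.Binary.PropositionalEquality using (_≡_; _≢_)

open import Data.Bool using (Bool; true; false; if_then_else_)
open import Data.List using (List; []; _∷_; _++_)
open import Data.Nat using (zero; suc; _+_; _∸_; _<_; _>_; _≤?_; s≤s; z<s)
open import Data.Nat.Induction using (<-wellFounded)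
open import Data.Nat.Properties
  using (+-commutativeSemigroup; m≤n+m; m+n∸n≡m; m∸n+n≡m; m<m+n; n<1+n; <-≤-trans; ≤-reflexive)
open import Algebra.Properties.CommutativeSemigroup +-commutativeSemigroup using (interchange; xy∙z≈xz∙y)
open import Data.Vec using ([]; _∷_)
open import Function using (_∘_)
open import Induction.WellFounded using (Acc; acc)
open import Relation.Binary.PropositionalEquality using (refl; sym; trans; cong; cong₂; subst; module ≡-Reasoning)
open import Relation.Nullary using (yes; no; contradiction)

opt : Bool → ℕ → List ℕ
opt b a = if b then a ∷ [] else []

opt-cong : ∀ b {a a′} → (b ≡ true → a ≡ a′) → opt b a ≡ opt b a′
opt-cong true  eq = cong (_∷ []) (eq refl)
opt-cong false eq = refl

-- Defs.mex searches with a local function, so it is reasoned about only by evaluating it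
-- on lists of length at most two.
mex-opt≢ˡ : ∀ {p} q a b → p ≡ true → mex (opt p a ++ opt q b) ≢ a
mex-opt≢ˡ false zero          b refl ()
mex-opt≢ˡ false (suc a)       b refl ()
mex-opt≢ˡ true  zero          zero          refl ()
mex-opt≢ˡ true  zero          (suc zero)    refl ()
mex-opt≢ˡ true  zero          (suc (suc b)) refl ()
mex-opt≢ˡ true  (suc zero)    zero          refl ()
mex-opt≢ˡ true  (suc (suc a)) zero          refl ()
mex-opt≢ˡ true  (suc a)       (suc b)       refl ()

mex-opt≢ʳ : ∀ p {q} a b → q ≡ true → mex (opt p a ++ opt q b) ≢ b
mex-opt≢ʳ false a zero          refl ()
mex-opt≢ʳ false a (suc b)       refl ()
mex-opt≢ʳ true  zero          zero          refl ()
mex-opt≢ʳ true  (suc zero)    zero          refl ()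
mex-opt≢ʳ true  (suc (suc a)) zero          refl ()
mex-opt≢ʳ true  zero          (suc zero)    refl ()
mex-opt≢ʳ true  zero          (suc (suc b)) refl ()
mex-opt≢ʳ true  (suc a)       (suc b)       refl ()

mex-pad : ∀ p q {a b m} → m ≡ mex (opt p a ++ opt q b) → a ≢ m → b ≢ m → m ≡ mex (a ∷ b ∷ [])
mex-pad true  true                        eq   _   _   = eq
mex-pad true  false {zero}  {zero}        refl _   _   = refl
mex-pad true  false {zero}  {suc zero}    refl _   b≢m = contradiction refl b≢m
mex-pad true  false {zero}  {suc (suc b)} refl _   _   = refl
mex-pad true  false {suc a} {zero}        refl _   b≢m = contradiction refl b≢m
mex-pad true  false {suc a} {suc b}       refl _   _   = refl
mex-pad false true  {zero}        {zero}  refl _   _   = refl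
mex-pad false true  {suc zero}    {zero}  refl a≢m _   = contradiction refl a≢m
mex-pad false true  {suc (suc a)} {zero}  refl _   _   = refl
mex-pad false true  {zero}        {suc b} refl a≢m _   = contradiction refl a≢m
mex-pad false true  {suc a}       {suc b} refl _   _   = refl
mex-pad false false {zero}  {b}           refl a≢m _   = contradiction refl a≢m
mex-pad false false {suc a} {zero}        refl _   b≢m = contradiction refl b≢m
mex-pad false false {suc a} {suc b}       refl _   _   = refl

m≤ᵛn+ᵛm : ∀ {n} (m k : Vec ℕ n) → m ≤ᵛ (k +ᵛ m) ≡ true
m≤ᵛn+ᵛm []      []      = refl
m≤ᵛn+ᵛm (a ∷ m) (c ∷ k) with a ≤? c + a
... | yes _   = m≤ᵛn+ᵛm m k
... | no  a≰c+a = contradiction (m≤n+m a c) a≰c+a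

m+ᵛn∸ᵛn≡m : ∀ {n} (m k : Vec ℕ n) → (m +ᵛ k) ∸ᵛ k ≡ m
m+ᵛn∸ᵛn≡m []      []      = refl
m+ᵛn∸ᵛn≡m (a ∷ m) (c ∷ k) = cong₂ _∷_ (m+n∸n≡m a c) (m+ᵛn∸ᵛn≡m m k)

m∸ᵛn+ᵛn≡m : ∀ {n} (m k : Vec ℕ n) → k ≤ᵛ m ≡ true → (m ∸ᵛ k) +ᵛ k ≡ m
m∸ᵛn+ᵛn≡m []      []      _  = refl
m∸ᵛn+ᵛn≡m (a ∷ m) (c ∷ k) le with c ≤? a
... | yes c≤a = cong₂ _∷_ (m∸n+n≡m c≤a) (m∸ᵛn+ᵛn≡m m k le)

+ᵛ-swapʳ : ∀ {n} (x y z : Vec ℕ n) → (x +ᵛ y) +ᵛ z ≡ (x +ᵛ z) +ᵛ y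
+ᵛ-swapʳ []      []      []      = refl
+ᵛ-swapʳ (a ∷ x) (b ∷ y) (c ∷ z) = cong₂ _∷_ (xy∙z≈xz∙y a b c) (+ᵛ-swapʳ x y z)

Σᵛ-+ᵛ : ∀ {n} (x y : Vec ℕ n) → Σᵛ (x +ᵛ y) ≡ Σᵛ x + Σᵛ y
Σᵛ-+ᵛ []      []      = refl
Σᵛ-+ᵛ (a ∷ x) (b ∷ y) = begin
  (a + b) + Σᵛ (x +ᵛ y)    ≡⟨ cong ((a + b) +_) (Σᵛ-+ᵛ x y) ⟩
  (a + b) + (Σᵛ x + Σᵛ y)  ≡⟨ interchange a b (Σᵛ x) (Σᵛ y) ⟩
  (a + Σᵛ x) + (b + Σᵛ y)  ∎
  where open ≡-Reasoning

Σᵛ-∸ᵛ-< : ∀ {n} (x w : Vec ℕ n) → w ≤ᵛ x ≡ true → Σᵛ w > 0 → Σᵛ (x ∸ᵛ w) < Σᵛ x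
Σᵛ-∸ᵛ-< x w w≤x Σw>0 = <-≤-trans (m<m+n (Σᵛ (x ∸ᵛ w)) Σw>0) (≤-reflexive Σ[x∸w]+Σw≡Σx)
  where
  open ≡-Reasoning
  Σ[x∸w]+Σw≡Σx : Σᵛ (x ∸ᵛ w) + Σᵛ w ≡ Σᵛ x
  Σ[x∸w]+Σw≡Σx = begin
    Σᵛ (x ∸ᵛ w) + Σᵛ w  ≡⟨ Σᵛ-+ᵛ (x ∸ᵛ w) w ⟨
    Σᵛ ((x ∸ᵛ w) +ᵛ w)  ≡⟨ cong Σᵛ (m∸ᵛn+ᵛn≡m x w w≤x) ⟩
    Σᵛ x                ∎

Σᵛ>0 : ∀ {n} (u : Vec ℕ n) → u ≢ replicate n 0 → Σᵛ u > 0
Σᵛ>0 []          u≢0 = contradiction refl u≢0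
Σᵛ>0 (zero  ∷ u) u≢0 = Σᵛ>0 u (u≢0 ∘ cong (0 ∷_))
Σᵛ>0 (suc a ∷ u) _   = z<s

module _ {n} (u v : Vec ℕ n) (Σu>0 : Σᵛ u > 0) (Σv>0 : Σᵛ v > 0) where

  options : (Vec ℕ n → ℕ) → Vec ℕ n → List ℕ
  options g x = opt (u ≤ᵛ x) (g (x ∸ᵛ u)) ++ opt (v ≤ᵛ x) (g (x ∸ᵛ v))

  options-cong : ∀ g h x → (∀ {w} → Σᵛ w > 0 → w ≤ᵛ x ≡ true → g (x ∸ᵛ w) ≡ h (x ∸ᵛ w)) →
                 options g x ≡ options h x
  options-cong g h x eq = cong₂ _++_ (opt-cong (u ≤ᵛ x) (eq Σu>0)) (opt-cong (v ≤ᵛ x) (eq Σv>0))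

  sgFuel-stable : ∀ {f g} x → Σᵛ x < f → Σᵛ x < g → sgFuel u v f x ≡ sgFuel u v g x
  sgFuel-stable {suc f} {suc g} x (s≤s Σx≤f) (s≤s Σx≤g) =
    cong mex (options-cong (sgFuel u v f) (sgFuel u v g) x λ {w} Σw>0 w≤x →
      let Σ[x∸w]<Σx = Σᵛ-∸ᵛ-< x w w≤x Σw>0
      in  sgFuel-stable (x ∸ᵛ w) (<-≤-trans Σ[x∸w]<Σx Σx≤f) (<-≤-trans Σ[x∸w]<Σx Σx≤g))

  SG-mex : ∀ x → SG u v x ≡ mex (options (SG u v) x)
  SG-mex x = cong mex (options-cong (sgFuel u v (Σᵛ x)) (SG u v) x λ {w} Σw>0 w≤x →
    sgFuel-stable (x ∸ᵛ w) (Σᵛ-∸ᵛ-< x w w≤x Σw>0) (n<1+n _))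

  SG≢SG[y∸u] : ∀ y → u ≤ᵛ y ≡ true → SG u v y ≢ SG u v (y ∸ᵛ u)
  SG≢SG[y∸u] y u≤y eq = mex-opt≢ˡ (v ≤ᵛ y) _ _ u≤y (trans (sym (SG-mex y)) eq)

  SG≢SG[y∸v] : ∀ y → v ≤ᵛ y ≡ true → SG u v y ≢ SG u v (y ∸ᵛ v)
  SG≢SG[y∸v] y v≤y eq = mex-opt≢ʳ (u ≤ᵛ y) _ _ v≤y (trans (sym (SG-mex y)) eq)

  SG[x+u]≢SG[x] : ∀ x → SG u v (x +ᵛ u) ≢ SG u v x
  SG[x+u]≢SG[x] x eq = SG≢SG[y∸u] (x +ᵛ u) (m≤ᵛn+ᵛm u x) (trans eq (cong (SG u v) (sym (m+ᵛn∸ᵛn≡m x u))))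

  SG[x+v]≢SG[x] : ∀ x → SG u v (x +ᵛ v) ≢ SG u v x
  SG[x+v]≢SG[x] x eq = SG≢SG[y∸v] (x +ᵛ v) (m≤ᵛn+ᵛm v x) (trans eq (cong (SG u v) (sym (m+ᵛn∸ᵛn≡m x v))))

  SG[x+u+v] : ∀ x → SG u v ((x +ᵛ u) +ᵛ v) ≡ mex (SG u v (x +ᵛ v) ∷ SG u v (x +ᵛ u) ∷ [])
  SG[x+u+v] x = begin
    SG u v y
      ≡⟨ SG-mex y ⟩
    mex (opt (u ≤ᵛ y) (SG u v (y ∸ᵛ u)) ++ opt (v ≤ᵛ y) (SG u v (y ∸ᵛ v)))
      ≡⟨ cong₂ (λ p q → mex (opt p (SG u v (y ∸ᵛ u)) ++ opt q (SG u v (y ∸ᵛ v)))) u≤y (m≤ᵛn+ᵛm v (x +ᵛ u)) ⟩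
    mex (SG u v (y ∸ᵛ u) ∷ SG u v (y ∸ᵛ v) ∷ [])
      ≡⟨ cong₂ (λ s t → mex (SG u v s ∷ SG u v t ∷ [])) y∸u≡x+v (m+ᵛn∸ᵛn≡m (x +ᵛ u) v) ⟩
    mex (SG u v (x +ᵛ v) ∷ SG u v (x +ᵛ u) ∷ [])
      ∎
    where
    open ≡-Reasoning
    y : Vec ℕ n
    y = (x +ᵛ u) +ᵛ v
    u≤y : u ≤ᵛ y ≡ true
    u≤y = subst (λ z → u ≤ᵛ z ≡ true) (sym (+ᵛ-swapʳ x u v)) (m≤ᵛn+ᵛm u (x +ᵛ v))
    y∸u≡x+v : y ∸ᵛ u ≡ x +ᵛ v
    y∸u≡x+v = trans (cong (_∸ᵛ u) (+ᵛ-swapʳ x u v)) (m+ᵛn∸ᵛn≡m (x +ᵛ v) u)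

  SG-periodic-acc : ∀ x → Acc _<_ (Σᵛ x) → SG u v x ≡ SG u v ((x +ᵛ u) +ᵛ v)
  SG-periodic-acc x (acc rs) =
    trans (mex-pad (u ≤ᵛ x) (v ≤ᵛ x) SG[x] (SG[x+v]≢SG[x] x) (SG[x+u]≢SG[x] x)) (sym (SG[x+u+v] x))
    where
    ih : ∀ w → Σᵛ w > 0 → w ≤ᵛ x ≡ true → SG u v (x ∸ᵛ w) ≡ SG u v (((x ∸ᵛ w) +ᵛ u) +ᵛ v)
    ih w Σw>0 w≤x = SG-periodic-acc (x ∸ᵛ w) (rs (Σᵛ-∸ᵛ-< x w w≤x Σw>0))
    [x∸u]+u+v≡x+v : u ≤ᵛ x ≡ true → ((x ∸ᵛ u) +ᵛ u) +ᵛ v ≡ x +ᵛ v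
    [x∸u]+u+v≡x+v u≤x = cong (_+ᵛ v) (m∸ᵛn+ᵛn≡m x u u≤x)
    [x∸v]+u+v≡x+u : v ≤ᵛ x ≡ true → ((x ∸ᵛ v) +ᵛ u) +ᵛ v ≡ x +ᵛ u
    [x∸v]+u+v≡x+u v≤x = trans (+ᵛ-swapʳ (x ∸ᵛ v) u v) (cong (_+ᵛ u) (m∸ᵛn+ᵛn≡m x v v≤x))
    SG[x] : SG u v x ≡ mex (opt (u ≤ᵛ x) (SG u v (x +ᵛ v)) ++ opt (v ≤ᵛ x) (SG u v (x +ᵛ u)))
    SG[x] = trans (SG-mex x) (cong mex (cong₂ _++_
      (opt-cong (u ≤ᵛ x) λ u≤x → trans (ih u Σu>0 u≤x) (cong (SG u v) ([x∸u]+u+v≡x+v u≤x)))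
      (opt-cong (v ≤ᵛ x) λ v≤x → trans (ih v Σv>0 v≤x) (cong (SG u v) ([x∸v]+u+v≡x+u v≤x)))))

  SG-periodic : ∀ x → SG u v x ≡ SG u v ((x +ᵛ u) +ᵛ v)
  SG-periodic x = SG-periodic-acc x (<-wellFounded (Σᵛ x))

mainTheorem16 : (n : ℕ) → 1 ≤ n → (u v : Vec ℕ n) → u ≢ replicate n 0 → v ≢ replicate n 0 →
    (x : Vec ℕ n) → SG u v x ≡ SG u v ((x +ᵛ u) +ᵛ v)
mainTheorem16 n _ u v u≢0 v≢0 = SG-periodic u v (Σᵛ>0 u u≢0) (Σᵛ>0 v v≢0)
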